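{- Consider the Markov fraction tree, generated from the neighbouring pair $\big((0,1),(1,2)\big)$ by the Springborn rule: whenever $\big((p_1,q_1),(p_2,q_2)\big)$ is a neighbouring pair, one forms $$p=\frac{p_1q_1+p_2q_2}{p_2q_1-p_1q_2},\qquad q=\frac{q_1^2+q_2^2}{p_2q_1-p_1q_2},$$ and declares $\big((p_1,q_1),(p,q)\big)$ and $\big((p,q),(p_2,q_2)\big)$ to be neighbouring pairs. Then every pair $(p,q)$ produced by this recursion (as well as the initial pairs $(0,1)$ and $(1,2)$) consists of coprime integers, and every such $q$ is a Markov number.
   Context: A Markov number is a positive integer that occurs as a coordinate of some positive integer solution $(x,y,z)$ of the Markov equation $x^2+y^2+z^2=3xyz$. In the recursion, $p$ and $q$ are a priori rational numbers given by the displayed formulas. -}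

module Defs where

open import Data.Nat as ℕ using (ℕ; _>_)
open import Data.Nat.Coprimality using (Coprime)
open import Data.Integer as ℤ using (ℤ; +_; ∣_∣)
open import Data.Rational as ℚ using (ℚ; _/_; _+_; _*_; _-_; _÷_; NonZero)
open import Data.Product using (_×_; _,_; ∃; ∃-syntax)
open import Data.Sum using (_⊎_)
open import Relation.Binary.PropositionalEquality using (_≡_)

Pair : Set
Pair = ℚ × ℚ

ι : ℤ → ℚ
ι n = n / 1

den : ℚ → ℚ → ℚ → ℚ → ℚ
den p₁ q₁ p₂ q₂ = p₂ * q₁ - p₁ * q₂

-- The rule is only applicable when the denominator is
-- nonzero (otherwise the fractions are undefined).
data Neighbouring : Pair → Pair → Set where
  base : Neighbouring (ι (+ 0) , ι (+ 1)) (ι (+ 1) , ι (+ 2))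
  left : ∀ {p₁ q₁ p₂ q₂} → Neighbouring (p₁ , q₁) (p₂ , q₂) →
         .{{nz : NonZero (den p₁ q₁ p₂ q₂)}} →
         Neighbouring (p₁ , q₁)
           ((p₁ * q₁ + p₂ * q₂) ÷ den p₁ q₁ p₂ q₂ , (q₁ * q₁ + q₂ * q₂) ÷ den p₁ q₁ p₂ q₂)
  right : ∀ {p₁ q₁ p₂ q₂} → Neighbouring (p₁ , q₁) (p₂ , q₂) →
         .{{nz : NonZero (den p₁ q₁ p₂ q₂)}} →
         Neighbouring
           ((p₁ * q₁ + p₂ * q₂) ÷ den p₁ q₁ p₂ q₂ , (q₁ * q₁ + q₂ * q₂) ÷ den p₁ q₁ p₂ q₂)
           (p₂ , q₂)

-- A pair produced by the recursion: a member of some neighbouring pair.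
InTree : Pair → Set
InTree x = ∃[ y ] (Neighbouring x y ⊎ Neighbouring y x)

-- Markov numbers: coordinates of positive integer solutions of x²+y²+z² = 3xyz
-- (by symmetry of the equation, wlog the first coordinate).
IsMarkov : ℕ → Set
IsMarkov x = ∃[ y ] ∃[ z ] (x > 0 × y > 0 × z > 0 ×
  x ℕ.* x ℕ.+ y ℕ.* y ℕ.+ z ℕ.* z ≡ 3 ℕ.* x ℕ.* y ℕ.* z)

-- For neighbouring fractions a/b, c/e with integer entries let t = cb - ae.  Along the tree
-- (b, e, t) is a Markov triple and t divides ab + ce, say tk = ab + ce.  Springborn's new
-- q = (b² + e²)/t is then the Vieta partner 3be - t of t in that triple, and the new p is k.
-- The identity ab + kq + ce = 3bek shows that both children divide in the same way, and the
-- new determinants kb - aq = e and cq - ke = b show that every common divisor of k and q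
-- divides b and e, so all fractions stay in lowest terms.
module Submission where

open import Defs
open import Data.Nat using (ℕ)
open import Data.Nat.Coprimality using (Coprime)
open import Data.Integer using (ℤ; +_; ∣_∣)
open import Data.Rational using (ℚ)
open import Data.Product using (_×_; _,_; ∃-syntax)
open import Relation.Binary.PropositionalEquality using (_≡_)

import Data.Nat as ℕ
import Data.Rational as ℚ
open import Data.List using (_∷_; [])
open import Data.Product using (proj₁; proj₂)
open import Data.Sum using (inj₁; inj₂)
open import Relation.Binary.PropositionalEquality
  using (refl; sym; trans; cong; cong₂; subst; module ≡-Reasoning)

module _ where
  open import Data.Nat
  open import Data.Nat.Properties
  open import Data.Nat.Tactic.RingSolver using (solve)

  MarkovTriple : ℕ → ℕ → ℕ → Set
  MarkovTriple x y z = x > 0 × y > 0 × z > 0 × x * x + y * y + z * z ≡ 3 * x * y * z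

  markov-swap₁₂ : ∀ {x y z} → MarkovTriple x y z → MarkovTriple y x z
  markov-swap₁₂ {x} {y} {z} (x>0 , y>0 , z>0 , eq) = y>0 , x>0 , z>0 , (begin
    y * y + x * x + z * z ≡⟨ solve (x ∷ y ∷ z ∷ []) ⟩
    x * x + y * y + z * z ≡⟨ eq ⟩
    3 * x * y * z         ≡⟨ solve (x ∷ y ∷ z ∷ []) ⟩
    3 * y * x * z         ∎)
    where open ≡-Reasoning

  markov-swap₂₃ : ∀ {x y z} → MarkovTriple x y z → MarkovTriple x z y
  markov-swap₂₃ {x} {y} {z} (x>0 , y>0 , z>0 , eq) = x>0 , z>0 , y>0 , (begin
    x * x + z * z + y * y ≡⟨ solve (x ∷ y ∷ z ∷ []) ⟩
    x * x + y * y + z * z ≡⟨ eq ⟩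
    3 * x * y * z         ≡⟨ solve (x ∷ y ∷ z ∷ []) ⟩
    3 * x * z * y         ∎)
    where open ≡-Reasoning

  -- The other root of  Z² - 3xyZ + x² + y², of which z is a root.
  vietaJump : ℕ → ℕ → ℕ → ℕ
  vietaJump x y z = 3 * x * y ∸ z

  markov-third<3xy : ∀ {x y z} → MarkovTriple x y z → z < 3 * x * y
  markov-third<3xy {suc x} {y} {z} (_ , _ , _ , eq) = *-cancelʳ-< z z (3 * suc x * y) (begin-strict
    z * z                          <⟨ m<n+m (z * z) z<s ⟩
    suc x * suc x + y * y + z * z  ≡⟨ eq ⟩
    3 * suc x * y * z              ∎)
    where open ≤-Reasoning

  vietaJump+third : ∀ {x y z} → MarkovTriple x y z → vietaJump x y z + z ≡ 3 * x * y
  vietaJump+third t = m∸n+n≡m (<⇒≤ (markov-third<3xy t))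

  third*vietaJump : ∀ {x y z} → MarkovTriple x y z → z * vietaJump x y z ≡ x * x + y * y
  third*vietaJump {x} {y} {z} t@(_ , _ , _ , eq) = +-cancelʳ-≡ (z * z) _ _ (begin
    z * w + z * z         ≡⟨ *-distribˡ-+ z w z ⟨
    z * (w + z)           ≡⟨ cong (z *_) (vietaJump+third t) ⟩
    z * (3 * x * y)       ≡⟨ *-comm z (3 * x * y) ⟩
    3 * x * y * z         ≡⟨ eq ⟨
    x * x + y * y + z * z ∎)
    where
    open ≡-Reasoning
    w = vietaJump x y z

  markov-vietaJump : ∀ {x y z} → MarkovTriple x y z → MarkovTriple x y (vietaJump x y z)
  markov-vietaJump {x} {y} {z} t@(x>0 , y>0 , _ , _) =
    x>0 , y>0 , m<n⇒0<n∸m (markov-third<3xy t) , (begin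
    x * x + y * y + w * w  ≡⟨ cong (_+ w * w) (third*vietaJump t) ⟨
    z * w + w * w          ≡⟨ *-distribʳ-+ w z w ⟨
    (z + w) * w            ≡⟨ cong (_* w) (+-comm z w) ⟩
    (w + z) * w            ≡⟨ cong (_* w) (vietaJump+third t) ⟩
    3 * x * y * w          ∎)
    where
    open ≡-Reasoning
    w = vietaJump x y z

module _ where
  open import Data.Integer
  open import Data.Integer.Properties
  open import Data.Integer.Divisibility.Signed
  open import Data.Integer.Tactic.RingSolver using (solve)

  coprime-if-divisors-divide : ∀ {x y u v} → Coprime ∣ u ∣ ∣ v ∣ →
    (∀ {d} → d ∣ x → d ∣ y → (d ∣ u) × (d ∣ v)) → Coprime ∣ x ∣ ∣ y ∣
  coprime-if-divisors-divide coprime-uv common-divisors {i} (i∣x , i∣y) =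
    coprime-uv (∣⇒∣ᵤ (proj₁ i∣u×v) , ∣⇒∣ᵤ (proj₂ i∣u×v))
    where i∣u×v = common-divisors (∣ᵤ⇒∣ {+ i} i∣x) (∣ᵤ⇒∣ {+ i} i∣y)

  module NeighbourAlgebra (a b c e t k q : ℤ) .{{_ : NonZero t}}
    (det : c * b - a * e ≡ t)
    (t*k : t * k ≡ a * b + c * e)
    (q+t : q + t ≡ + 3 * b * e)
    (t*q : t * q ≡ b * b + e * e)
    where
    open ≡-Reasoning

    det-left : k * b - a * q ≡ e
    det-left = *-cancelˡ-≡ t _ _ (begin
      t * (k * b - a * q)                      ≡⟨ solve (a ∷ b ∷ k ∷ q ∷ t ∷ []) ⟩
      (t * k) * b - a * (t * q)                ≡⟨ cong₂ (λ u v → u * b - a * v) t*k t*q ⟩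
      (a * b + c * e) * b - a * (b * b + e * e) ≡⟨ solve (a ∷ b ∷ c ∷ e ∷ []) ⟩
      e * (c * b - a * e)                      ≡⟨ cong (e *_) det ⟩
      e * t                                    ≡⟨ *-comm e t ⟩
      t * e                                    ∎)

    det-right : c * q - k * e ≡ b
    det-right = *-cancelˡ-≡ t _ _ (begin
      t * (c * q - k * e)                      ≡⟨ solve (c ∷ e ∷ k ∷ q ∷ t ∷ []) ⟩
      c * (t * q) - (t * k) * e                ≡⟨ cong₂ (λ u v → c * u - v * e) t*q t*k ⟩
      c * (b * b + e * e) - (a * b + c * e) * e ≡⟨ solve (a ∷ b ∷ c ∷ e ∷ []) ⟩
      b * (c * b - a * e)                      ≡⟨ cong (b *_) det ⟩
      b * t                                    ≡⟨ *-comm b t ⟩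
      t * b                                    ∎)

    sum-of-products : a * b + k * q + c * e ≡ + 3 * b * e * k
    sum-of-products = begin
      a * b + k * q + c * e   ≡⟨ solve (a ∷ b ∷ c ∷ e ∷ k ∷ q ∷ []) ⟩
      k * q + (a * b + c * e) ≡⟨ cong (_+_ (k * q)) t*k ⟨
      k * q + t * k           ≡⟨ solve (k ∷ q ∷ t ∷ []) ⟩
      k * (q + t)             ≡⟨ cong (k *_) q+t ⟩
      k * (+ 3 * b * e)       ≡⟨ solve (b ∷ e ∷ k ∷ []) ⟩
      + 3 * b * e * k         ∎

    divides-left : e * (+ 3 * b * k - c) ≡ a * b + k * q
    divides-left = begin
      e * (+ 3 * b * k - c)         ≡⟨ solve (b ∷ c ∷ e ∷ k ∷ []) ⟩
      + 3 * b * e * k - c * e       ≡⟨ cong (_- c * e) sum-of-products ⟨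
      a * b + k * q + c * e - c * e ≡⟨ solve (a ∷ b ∷ c ∷ e ∷ k ∷ q ∷ []) ⟩
      a * b + k * q                 ∎

    divides-right : b * (+ 3 * e * k - a) ≡ k * q + c * e
    divides-right = begin
      b * (+ 3 * e * k - a)         ≡⟨ solve (a ∷ b ∷ e ∷ k ∷ []) ⟩
      + 3 * b * e * k - a * b       ≡⟨ cong (_- a * b) sum-of-products ⟨
      a * b + k * q + c * e - a * b ≡⟨ solve (a ∷ b ∷ c ∷ e ∷ k ∷ q ∷ []) ⟩
      k * q + c * e                 ∎

    module _ (coprime-b-e : Coprime ∣ b ∣ ∣ e ∣) where

      coprime-k-q : Coprime ∣ k ∣ ∣ q ∣
      coprime-k-q = coprime-if-divisors-divide {k} {q} coprime-b-e λ d∣k d∣q →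
        subst (_ ∣_) det-right (∣m∣n⇒∣m-n (∣n⇒∣m*n c d∣q) (∣m⇒∣m*n e d∣k)) ,
        subst (_ ∣_) det-left (∣m∣n⇒∣m-n (∣m⇒∣m*n b d∣k) (∣n⇒∣m*n a d∣q))

      coprime-b-q : Coprime ∣ b ∣ ∣ q ∣
      coprime-b-q = coprime-if-divisors-divide {b} {q} coprime-b-e λ d∣b d∣q →
        d∣b , subst (_ ∣_) det-left (∣m∣n⇒∣m-n (∣n⇒∣m*n k d∣b) (∣n⇒∣m*n a d∣q))

      coprime-q-e : Coprime ∣ q ∣ ∣ e ∣
      coprime-q-e = coprime-if-divisors-divide {q} {e} coprime-b-e λ d∣q d∣e →
        subst (_ ∣_) det-right (∣m∣n⇒∣m-n (∣n⇒∣m*n c d∣q) (∣n⇒∣m*n k d∣e)) , d∣e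

module _ where
  open import Data.Integer
  open import Data.Integer.Tactic.RingSolver using (solve)
  import Data.Integer.Properties as ℤ
  open import Data.Rational.Properties
    using ( toℚᵘ-fromℚᵘ; toℚᵘ-injective; toℚᵘ-homo-+; toℚᵘ-homo-*; toℚᵘ-homo‿-
          ; *-assoc; *-inverseʳ; *-identityʳ)
  open import Data.Rational.Unnormalised as ℚᵘ using (mkℚᵘ; *≡*)
  import Data.Rational.Unnormalised.Properties as ℚᵘ
  open ≡-Reasoning

  toℚᵘ-ι : ∀ n → ℚ.toℚᵘ (ι n) ℚᵘ.≃ mkℚᵘ n 0
  toℚᵘ-ι n = toℚᵘ-fromℚᵘ (mkℚᵘ n 0)

  ι-+ : ∀ m n → ι m ℚ.+ ι n ≡ ι (m + n)
  ι-+ m n = toℚᵘ-injective (ℚᵘ.≃-trans (toℚᵘ-homo-+ (ι m) (ι n))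
    (ℚᵘ.≃-trans (ℚᵘ.+-cong (toℚᵘ-ι m) (toℚᵘ-ι n))
    (ℚᵘ.≃-trans (*≡* cross-multiplied) (ℚᵘ.≃-sym (toℚᵘ-ι (m + n))))))
    where
    cross-multiplied : (m * + 1 + n * + 1) * + 1 ≡ (m + n) * + 1
    cross-multiplied = solve (m ∷ n ∷ [])

  ι-* : ∀ m n → ι m ℚ.* ι n ≡ ι (m * n)
  ι-* m n = toℚᵘ-injective (ℚᵘ.≃-trans (toℚᵘ-homo-* (ι m) (ι n))
    (ℚᵘ.≃-trans (ℚᵘ.*-cong (toℚᵘ-ι m) (toℚᵘ-ι n)) (ℚᵘ.≃-sym (toℚᵘ-ι (m * n)))))

  ι-neg : ∀ n → ℚ.- ι n ≡ ι (- n)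
  ι-neg n = toℚᵘ-injective (ℚᵘ.≃-trans (toℚᵘ-homo‿- (ι n))
    (ℚᵘ.≃-trans (ℚᵘ.-‿cong (toℚᵘ-ι n)) (ℚᵘ.≃-sym (toℚᵘ-ι (- n)))))

  ι-*+* : ∀ a b c d → ι a ℚ.* ι b ℚ.+ ι c ℚ.* ι d ≡ ι (a * b + c * d)
  ι-*+* a b c d = trans (cong₂ ℚ._+_ (ι-* a b) (ι-* c d)) (ι-+ (a * b) (c * d))

  ι-*-* : ∀ a b c d → ι a ℚ.* ι b ℚ.- ι c ℚ.* ι d ≡ ι (a * b - c * d)
  ι-*-* a b c d = trans (cong₂ ℚ._-_ (ι-* a b) (ι-* c d))
    (trans (cong (ι (a * b) ℚ.+_) (ι-neg (c * d))) (ι-+ (a * b) (- (c * d))))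

  ÷-ι : ∀ {x y m} t n .{{_ : ℚ.NonZero y}} → x ≡ ι m → y ≡ ι t → t * n ≡ m → x ℚ.÷ y ≡ ι n
  ÷-ι {m = m} t n refl refl t*n≡m = begin
    ι m ℚ.* ℚ.1/ ι t           ≡⟨ cong (λ z → ι z ℚ.* ℚ.1/ ι t) (trans (ℤ.*-comm n t) t*n≡m) ⟨
    ι (n * t) ℚ.* ℚ.1/ ι t     ≡⟨ cong (ℚ._* ℚ.1/ ι t) (ι-* n t) ⟨
    ι n ℚ.* ι t ℚ.* ℚ.1/ ι t   ≡⟨ *-assoc (ι n) (ι t) (ℚ.1/ ι t) ⟩
    ι n ℚ.* (ι t ℚ.* ℚ.1/ ι t) ≡⟨ cong (ι n ℚ.*_) (*-inverseʳ (ι t)) ⟩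
    ι n ℚ.* ℚ.1ℚ               ≡⟨ *-identityʳ (ι n) ⟩
    ι n                        ∎

open import Data.Integer using (NonZero; _+_; _*_; _-_)
open import Data.Integer.Properties using (pos-+; pos-*)
open import Data.Nat.Coprimality using (1-coprimeTo) renaming (sym to coprime-sym)

record IntegralNeighbours (a : ℤ) (b : ℕ) (c : ℤ) (e : ℕ) : Set where
  field
    t : ℕ
    k : ℤ
    markov : MarkovTriple b e t
    det : c * + b - a * + e ≡ + t
    t*k : + t * k ≡ a * + b + c * + e
    coprime-b-e : Coprime b e
    coprime-a-b : Coprime ∣ a ∣ b
    coprime-c-e : Coprime ∣ c ∣ e

initialNeighbours : IntegralNeighbours (+ 0) 1 (+ 1) 2
initialNeighbours = record
  { t = 1 ; k = + 2 ; markov = ℕ.z<s , ℕ.z<s , ℕ.z<s , refl ; det = refl ; t*k = refl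
  ; coprime-b-e = 1-coprimeTo 2 ; coprime-a-b = coprime-sym (1-coprimeTo 0)
  ; coprime-c-e = 1-coprimeTo 2 }

child : (p₁ q₁ p₂ q₂ : ℚ) .{{_ : ℚ.NonZero (den p₁ q₁ p₂ q₂)}} → Pair
child p₁ q₁ p₂ q₂ =
    (p₁ ℚ.* q₁ ℚ.+ p₂ ℚ.* q₂) ℚ.÷ den p₁ q₁ p₂ q₂
  , (q₁ ℚ.* q₁ ℚ.+ q₂ ℚ.* q₂) ℚ.÷ den p₁ q₁ p₂ q₂

module Children {a b c e} (N : IntegralNeighbours a b c e) where
  open IntegralNeighbours N
  open ≡-Reasoning

  q : ℕ
  q = vietaJump b e t

  instance
    t≢0 : NonZero (+ t)
    t≢0 = ℕ.>-nonZero (proj₁ (proj₂ (proj₂ markov)))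

  q+t : + q + + t ≡ + 3 * + b * + e
  q+t = begin
    + q + + t         ≡⟨ pos-+ q t ⟨
    + (q ℕ.+ t)       ≡⟨ cong +_ (vietaJump+third markov) ⟩
    + (3 ℕ.* b ℕ.* e) ≡⟨ pos-* (3 ℕ.* b) e ⟩
    + (3 ℕ.* b) * + e ≡⟨ cong (_* + e) (pos-* 3 b) ⟩
    + 3 * + b * + e   ∎

  t*q : + t * + q ≡ + b * + b + + e * + e
  t*q = begin
    + t * + q                 ≡⟨ pos-* t q ⟨
    + (t ℕ.* q)               ≡⟨ cong +_ (third*vietaJump markov) ⟩
    + (b ℕ.* b ℕ.+ e ℕ.* e)   ≡⟨ pos-+ (b ℕ.* b) (e ℕ.* e) ⟩
    + (b ℕ.* b) + + (e ℕ.* e) ≡⟨ cong₂ _+_ (pos-* b b) (pos-* e e) ⟩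
    + b * + b + + e * + e     ∎

  open NeighbourAlgebra a (+ b) c (+ e) (+ t) k (+ q) det t*k q+t t*q

  leftChild : IntegralNeighbours a b k q
  leftChild = record
    { t = e ; k = + 3 * + b * k - c
    ; markov = markov-swap₂₃ (markov-vietaJump markov)
    ; det = det-left ; t*k = divides-left
    ; coprime-b-e = coprime-b-q coprime-b-e ; coprime-a-b = coprime-a-b
    ; coprime-c-e = coprime-k-q coprime-b-e }

  rightChild : IntegralNeighbours k q c e
  rightChild = record
    { t = b ; k = + 3 * + e * k - a
    ; markov = markov-swap₁₂ (markov-swap₂₃ (markov-swap₁₂ (markov-vietaJump markov)))
    ; det = det-right ; t*k = divides-right
    ; coprime-b-e = coprime-q-e coprime-b-e ; coprime-a-b = coprime-k-q coprime-b-e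
    ; coprime-c-e = coprime-c-e }

  child≡ : .{{_ : ℚ.NonZero (den (ι a) (ι (+ b)) (ι c) (ι (+ e)))}} →
    child (ι a) (ι (+ b)) (ι c) (ι (+ e)) ≡ (ι k , ι (+ q))
  child≡ = cong₂ _,_
    (÷-ι (c * + b - a * + e) k (ι-*+* a (+ b) c (+ e)) den≡ (trans (cong (_* k) det) t*k))
    (÷-ι (c * + b - a * + e) (+ q) (ι-*+* (+ b) (+ b) (+ e) (+ e)) den≡ (trans (cong (_* + q) det) t*q))
    where den≡ = ι-*-* c (+ b) a (+ e)

data Integral : Pair → Pair → Set where
  integral : ∀ {a b c e} → IntegralNeighbours a b c e → Integral (ι a , ι (+ b)) (ι c , ι (+ e))

integral-leftChild : ∀ {p₁ q₁ p₂ q₂} .{{_ : ℚ.NonZero (den p₁ q₁ p₂ q₂)}} →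
  Integral (p₁ , q₁) (p₂ , q₂) → Integral (p₁ , q₁) (child p₁ q₁ p₂ q₂)
integral-leftChild (integral N) =
  subst (Integral _) (sym (Children.child≡ N)) (integral (Children.leftChild N))

integral-rightChild : ∀ {p₁ q₁ p₂ q₂} .{{_ : ℚ.NonZero (den p₁ q₁ p₂ q₂)}} →
  Integral (p₁ , q₁) (p₂ , q₂) → Integral (child p₁ q₁ p₂ q₂) (p₂ , q₂)
integral-rightChild (integral N) =
  subst (λ w → Integral w _) (sym (Children.child≡ N)) (integral (Children.rightChild N))

integral-neighbours : ∀ {w₁ w₂} → Neighbouring w₁ w₂ → Integral w₁ w₂
integral-neighbours base      = integral initialNeighbours
integral-neighbours (left n)  = integral-leftChild (integral-neighbours n)
integral-neighbours (right n) = integral-rightChild (integral-neighbours n)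

proposition2p1 : ∀ (p q : ℚ) → InTree (p , q) →
    ∃[ a ] ∃[ b ] (p ≡ ι a × q ≡ ι b × Coprime ∣ a ∣ ∣ b ∣ ×
      ∃[ n ] (b ≡ + n × IsMarkov n))
proposition2p1 p q (_ , inj₁ n) with integral-neighbours n
... | integral {a} {b} {e = e} N =
  a , + b , refl , refl , coprime-a-b , b , refl , e , t , markov
  where open IntegralNeighbours N
proposition2p1 p q (_ , inj₂ n) with integral-neighbours n
... | integral {b = b} {c} {e} N =
  c , + e , refl , refl , coprime-c-e , e , refl , b , t , markov-swap₁₂ markov
  where open IntegralNeighbours N
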